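{- Let $n$ be a positive integer and let $t$ be an integer with $1\le t\le 2^n-2$ and $\gcd(t-2,2^n-1)=1$. If the function $x\mapsto cx^t$ is planar on $\mathbb{F}_{2^n}$ for some $c\in\mathbb{F}_{2^n}^*$, then $t$ is a power of $2$.
   Context: A function $f:\mathbb{F}_{2^n}\to\mathbb{F}_{2^n}$ is planar if for every $\epsilon\in\mathbb{F}_{2^n}^*$ the map $x\mapsto f(x+\epsilon)+f(x)+\epsilon x$ is a permutation of $\mathbb{F}_{2^n}$. -}

module Defs where

open import Level using (Level; suc; _⊔_)
open import Data.Nat using (ℕ; zero; suc; _^_)
open import Data.Fin using (Fin)
open import Data.Product using (∃)
open import Relation.Binary.PropositionalEquality using (_≡_)
open import Relation.Nullary using (¬_)
open import Algebra.Structures using (IsCommutativeRing)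
open import Function.Bundles using (_⤖_)
open import Function.Definitions using (Bijective)

-- A finite field with 2^n elements (equality is propositional equality).
-- Any such field is "the" field F_{2^n} (unique up to isomorphism).
record FiniteField (n : ℕ) (ℓ : Level) : Set (Level.suc ℓ) where
  infixl 6 _+_
  infixl 7 _*_
  field
    Carrier : Set ℓ
    _+_ _*_ : Carrier → Carrier → Carrier
    -_      : Carrier → Carrier
    0# 1#   : Carrier
    isCommutativeRing : IsCommutativeRing _≡_ _+_ _*_ -_ 0# 1#
    0≢1     : ¬ (0# ≡ 1#)
    inverse : ∀ x → ¬ (x ≡ 0#) → ∃ λ y → x * y ≡ 1#
    card    : Carrier ⤖ Fin (2 ^ n)

  _^′_ : Carrier → ℕ → Carrier
  x ^′ zero  = 1#
  x ^′ suc k = x * (x ^′ k)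

  Planar : (Carrier → Carrier) → Set ℓ
  Planar f = ∀ ε → ¬ (ε ≡ 0#) → Bijective _≡_ _≡_ (λ x → f (x + ε) + f x + ε * x)

module Submission where

-- Write t = m + 2 and g(y) = (y + 1)^t + y^t. The planarity map satisfies D_ε(εy) = ε²(c ε^m g(y) + y),
-- and since gcd(m, q - 1) = 1 every nonzero a has the form c ε^m, so every map y ↦ a g(y) + y is
-- injective; this forces g to be constant, g ≡ g(0) = 1. At y = 1 this gives 2^t = 0, so the
-- characteristic is 2 and (y + 1)^t = y^t + 1 on the whole field. An exponent t < q with this property
-- is a power of 2: for even t, t/2 inherits it because squaring is injective; for odd t > 1 the
-- polynomial (X + 1)^t + X^t + 1 has fewer than q coefficients and vanishes on all of F_q, yet its
-- X-coefficient is t = 1.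

open import Defs
open import Level using (Level)
open import Data.Nat as ℕ using (ℕ; zero; suc; _^_; _≤_; _<_; _∸_; NonZero; z≤n; s≤s)
import Data.Nat.Properties as ℕ
open import Data.Nat.Coprimality using (Coprime; coprime-Bézout; gcd≡1⇒coprime)
open import Data.Nat.GCD using (module Bézout)
open import Data.Nat.Induction using (<-rec)
open import Data.Fin as Fin using (punchIn)
open import Data.Fin.Properties using (punchInᵢ≢i; suc-injective)
open import Data.Fin.Permutation using (Permutation′; permutation; _⟨$⟩ʳ_)
open import Data.Vec.Functional using (Vector)
open import Data.Product using (∃; _×_; _,_; proj₁; proj₂)
open import Data.Sum using (_⊎_; inj₁; inj₂)
open import Data.List using (List; []; _∷_; length)
open import Data.List.Relation.Unary.All using (All; []; _∷_)
open import Data.Maybe using (nothing)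
open import Function using (_∘_)
open import Function.Bundles using (Inverse)
open import Function.Definitions using (Injective)
open import Function.Properties.Bijection using (⤖⇒↔)
open import Relation.Binary.Definitions using (DecidableEquality)
open import Relation.Binary.PropositionalEquality
open import Relation.Nullary using (¬_; yes; no)
open import Relation.Nullary.Decidable using (map′)
open import Relation.Nullary.Negation using (contradiction)
open import Algebra.Bundles using (CommutativeRing)
open import Tactic.RingSolver.Core.AlmostCommutativeRing using (AlmostCommutativeRing; fromCommutativeRing)

data EvenOdd : ℕ → Set where
  even : ∀ h → EvenOdd (h ℕ.+ h)
  odd  : ∀ h → EvenOdd (suc (h ℕ.+ h))

evenOdd : ∀ s → EvenOdd s
evenOdd zero    = even 0
evenOdd (suc s) with evenOdd s
... | even h = odd h
... | odd  h = subst EvenOdd (cong suc (ℕ.+-suc h h)) (even (suc h))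

module FiniteFieldTheory {ℓ : Level} {n : ℕ} (F : FiniteField n ℓ) where
  open FiniteField F

  commutativeRing : CommutativeRing ℓ ℓ
  commutativeRing = record { isCommutativeRing = isCommutativeRing }

  open CommutativeRing commutativeRing
    using (+-assoc; +-comm; +-identityˡ; +-identityʳ;
           *-assoc; *-comm; *-identityˡ; *-identityʳ; distribˡ; distribʳ; zeroˡ; zeroʳ;
           *-commutativeMonoid; +-group; _-_)
  open import Algebra.Properties.Group +-group using (x∙y⁻¹≈ε⇒x≈y; //-rightDividesˡ; ∙-cancelʳ)
  open Inverse (⤖⇒↔ card) using (to; from; strictlyInverseˡ; strictlyInverseʳ)
  open import Algebra.Properties.CommutativeMonoid.Sum *-commutativeMonoid
    using (sum-remove; sum-permute; sum-cong-≗) renaming (sum to ∏; ∑-distrib-+ to ∏-distrib-*)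
  open ≡-Reasoning

  ring : AlmostCommutativeRing ℓ ℓ
  ring = fromCommutativeRing commutativeRing (λ _ → nothing)

  open import Tactic.RingSolver.NonReflective ring using (solve; _⊜_; _⊕_; _⊗_)

  q : ℕ
  q = 2 ^ n

  from-injective : Injective _≡_ _≡_ from
  from-injective {i} {j} eq = trans (sym (strictlyInverseˡ i)) (trans (cong to eq) (strictlyInverseˡ j))

  infix 4 _≟_
  _≟_ : DecidableEquality Carrier
  x ≟ y = map′ to-injective (cong to) (to x Fin.≟ to y)
    where
    to-injective : Injective _≡_ _≡_ to
    to-injective {x} {y} eq = trans (sym (strictlyInverseʳ x)) (trans (cong from eq) (strictlyInverseʳ y))

  1≢0 : 1# ≢ 0#
  1≢0 = 0≢1 ∘ sym

  _⁻¹⟨_⟩ : ∀ x → x ≢ 0# → Carrier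
  x ⁻¹⟨ x≢0 ⟩ = proj₁ (inverse x x≢0)

  x*x⁻¹≡1 : ∀ {x} (x≢0 : x ≢ 0#) → x * x ⁻¹⟨ x≢0 ⟩ ≡ 1#
  x*x⁻¹≡1 {x} x≢0 = proj₂ (inverse x x≢0)

  x⁻¹*x≡1 : ∀ {x} (x≢0 : x ≢ 0#) → x ⁻¹⟨ x≢0 ⟩ * x ≡ 1#
  x⁻¹*x≡1 {x} x≢0 = trans (*-comm _ x) (x*x⁻¹≡1 x≢0)

  x⁻¹≢0 : ∀ {x} (x≢0 : x ≢ 0#) → x ⁻¹⟨ x≢0 ⟩ ≢ 0#
  x⁻¹≢0 {x} x≢0 x⁻¹≡0 = 1≢0 (begin
    1#                ≡⟨ x*x⁻¹≡1 x≢0 ⟨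
    x * x ⁻¹⟨ x≢0 ⟩   ≡⟨ cong (x *_) x⁻¹≡0 ⟩
    x * 0#            ≡⟨ zeroʳ x ⟩
    0#                ∎)

  *-cancelˡ : ∀ {x y z} → x ≢ 0# → x * y ≡ x * z → y ≡ z
  *-cancelˡ {x} {y} {z} x≢0 eq = begin
    y                 ≡⟨ *-identityˡ y ⟨
    1# * y            ≡⟨ cong (_* y) (x⁻¹*x≡1 x≢0) ⟨
    (x⁻¹ * x) * y     ≡⟨ *-assoc x⁻¹ x y ⟩
    x⁻¹ * (x * y)     ≡⟨ cong (x⁻¹ *_) eq ⟩
    x⁻¹ * (x * z)     ≡⟨ *-assoc x⁻¹ x z ⟨
    (x⁻¹ * x) * z     ≡⟨ cong (_* z) (x⁻¹*x≡1 x≢0) ⟩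
    1# * z            ≡⟨ *-identityˡ z ⟩
    z                 ∎
    where x⁻¹ = x ⁻¹⟨ x≢0 ⟩

  *-cancelʳ : ∀ {x y z} → x ≢ 0# → y * x ≡ z * x → y ≡ z
  *-cancelʳ {x} {y} {z} x≢0 eq = *-cancelˡ x≢0 (trans (*-comm x y) (trans eq (*-comm z x)))

  x*y≡0⇒x≡0⊎y≡0 : ∀ {x y} → x * y ≡ 0# → x ≡ 0# ⊎ y ≡ 0#
  x*y≡0⇒x≡0⊎y≡0 {x} {y} xy≡0 with x ≟ 0#
  ... | yes x≡0 = inj₁ x≡0
  ... | no  x≢0 = inj₂ (*-cancelˡ x≢0 (trans xy≡0 (sym (zeroʳ x))))

  x*y≢0 : ∀ {x y} → x ≢ 0# → y ≢ 0# → x * y ≢ 0#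
  x*y≢0 x≢0 y≢0 xy≡0 with x*y≡0⇒x≡0⊎y≡0 xy≡0
  ... | inj₁ x≡0 = x≢0 x≡0
  ... | inj₂ y≡0 = y≢0 y≡0

  ^′-distribˡ-+-* : ∀ x a b → x ^′ (a ℕ.+ b) ≡ x ^′ a * x ^′ b
  ^′-distribˡ-+-* x zero    b = sym (*-identityˡ _)
  ^′-distribˡ-+-* x (suc a) b = trans (cong (x *_) (^′-distribˡ-+-* x a b)) (sym (*-assoc _ _ _))

  ^′-distribʳ-* : ∀ x y k → (x * y) ^′ k ≡ x ^′ k * y ^′ k
  ^′-distribʳ-* x y zero    = sym (*-identityˡ 1#)
  ^′-distribʳ-* x y (suc k) = trans (cong ((x * y) *_) (^′-distribʳ-* x y k))
    (solve 4 (λ x y a b → (x ⊗ y) ⊗ (a ⊗ b) ⊜ (x ⊗ a) ⊗ (y ⊗ b)) refl x y (x ^′ k) (y ^′ k))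

  1^′k≡1 : ∀ k → 1# ^′ k ≡ 1#
  1^′k≡1 zero    = refl
  1^′k≡1 (suc k) = trans (cong (1# *_) (1^′k≡1 k)) (*-identityˡ 1#)

  ^′-*-assoc : ∀ x a b → (x ^′ a) ^′ b ≡ x ^′ (a ℕ.* b)
  ^′-*-assoc x zero    b = 1^′k≡1 b
  ^′-*-assoc x (suc a) b = begin
    (x * x ^′ a) ^′ b         ≡⟨ ^′-distribʳ-* x (x ^′ a) b ⟩
    x ^′ b * (x ^′ a) ^′ b    ≡⟨ cong (x ^′ b *_) (^′-*-assoc x a b) ⟩
    x ^′ b * x ^′ (a ℕ.* b)   ≡⟨ ^′-distribˡ-+-* x b (a ℕ.* b) ⟨
    x ^′ (b ℕ.+ a ℕ.* b)      ∎

  0^′k≡0 : ∀ k .{{_ : NonZero k}} → 0# ^′ k ≡ 0#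
  0^′k≡0 (suc k) = zeroˡ _

  x^′k≢0 : ∀ {x} k → x ≢ 0# → x ^′ k ≢ 0#
  x^′k≢0 zero    x≢0 = 1≢0
  x^′k≢0 (suc k) x≢0 = x*y≢0 x≢0 (x^′k≢0 k x≢0)

  x^′k≡0⇒x≡0 : ∀ {x} k → x ^′ k ≡ 0# → x ≡ 0#
  x^′k≡0⇒x≡0 {x} k xᵏ≡0 with x ≟ 0#
  ... | yes x≡0 = x≡0
  ... | no  x≢0 = contradiction xᵏ≡0 (x^′k≢0 k x≢0)

  ∏-const : ∀ k x → ∏ {k} (λ _ → x) ≡ x ^′ k
  ∏-const zero    x = refl
  ∏-const (suc k) x = cong (x *_) (∏-const k x)

  ∏≢0 : ∀ {k} (f : Vector Carrier k) → (∀ i → f i ≢ 0#) → ∏ f ≢ 0#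
  ∏≢0 {zero}  f f≢0 = 1≢0
  ∏≢0 {suc k} f f≢0 = x*y≢0 (f≢0 Fin.zero) (∏≢0 (f ∘ Fin.suc) (f≢0 ∘ Fin.suc))

  ∏-exchange : ∀ {k} (f g : Vector Carrier k) i → (∀ j → j ≢ i → f j ≡ g j) → ∏ f * g i ≡ ∏ g * f i
  ∏-exchange {suc k} f g i agree = begin
    ∏ f * g i                           ≡⟨ cong (_* g i) (sum-remove f) ⟩
    (f i * ∏ (f ∘ punchIn i)) * g i     ≡⟨ cong (λ r → (f i * r) * g i) (sum-cong-≗ (λ j → agree _ (punchInᵢ≢i i j))) ⟩
    (f i * ∏ (g ∘ punchIn i)) * g i     ≡⟨ solve 3 (λ a b r → (a ⊗ r) ⊗ b ⊜ (b ⊗ r) ⊗ a) refl (f i) (g i) _ ⟩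
    (g i * ∏ (g ∘ punchIn i)) * f i     ≡⟨ cong (_* f i) (sum-remove g) ⟨
    ∏ g * f i                           ∎

  orOne : Carrier → Carrier
  orOne z with z ≟ 0#
  ... | yes _ = 1#
  ... | no  _ = z

  orOne≢0 : ∀ z → orOne z ≢ 0#
  orOne≢0 z with z ≟ 0#
  ... | yes _   = 1≢0
  ... | no  z≢0 = z≢0

  orOne-0 : orOne 0# ≡ 1#
  orOne-0 with 0# ≟ 0#
  ... | yes _   = refl
  ... | no  0≢0 = contradiction refl 0≢0

  orOne-*ˡ : ∀ {x z} → x ≢ 0# → z ≢ 0# → orOne (x * z) ≡ x * orOne z
  orOne-*ˡ {x} {z} x≢0 z≢0 with z ≟ 0# | x * z ≟ 0#
  ... | yes z≡0 | _         = contradiction z≡0 z≢0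
  ... | no  _   | yes xz≡0  = contradiction xz≡0 (x*y≢0 x≢0 z≢0)
  ... | no  _   | no  _     = refl

  -- Multiplication by x permutes the field, so ∏_z orOne (x z) = ∏_z orOne z, while
  -- ∏_z x · orOne z = x^q ∏_z orOne z; the two products differ only in the factor at z = 0.
  x^′q≡x : ∀ {x} → x ≢ 0# → x ^′ q ≡ x
  x^′q≡x {x} x≢0 = sym (*-cancelˡ P≢0 (begin
    P * x                                   ≡⟨ cong (_* x) ∏f≡P ⟨
    ∏ f * x                                 ≡⟨ cong (∏ f *_) g₀≡x ⟨
    ∏ f * g (to 0#)                         ≡⟨ ∏-exchange f g (to 0#) f≡g-off-0 ⟩
    ∏ g * f (to 0#)                         ≡⟨ cong (∏ g *_) f₀≡1 ⟩
    ∏ g * 1#                                ≡⟨ *-identityʳ (∏ g) ⟩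
    ∏ g                                     ≡⟨ ∏-distrib-* (λ _ → x) (orOne ∘ from) ⟩
    ∏ {q} (λ _ → x) * P                     ≡⟨ cong (_* P) (∏-const q x) ⟩
    x ^′ q * P                              ≡⟨ *-comm (x ^′ q) P ⟩
    P * x ^′ q                              ∎))
    where
    P : Carrier
    P = ∏ (orOne ∘ from)
    f g : Vector Carrier q
    f i = orOne (x * from i)
    g i = x * orOne (from i)

    P≢0 : P ≢ 0#
    P≢0 = ∏≢0 (orOne ∘ from) (orOne≢0 ∘ from)

    π : Permutation′ q
    π = permutation (λ i → to (x * from i)) (λ i → to (x ⁻¹⟨ x≢0 ⟩ * from i))
          (λ i → cancel x (x ⁻¹⟨ x≢0 ⟩) (x*x⁻¹≡1 x≢0) i)
          (λ i → cancel (x ⁻¹⟨ x≢0 ⟩) x (x⁻¹*x≡1 x≢0) i)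
      where
      cancel : ∀ a b → a * b ≡ 1# → ∀ i → to (a * from (to (b * from i))) ≡ i
      cancel a b ab≡1 i = begin
        to (a * from (to (b * from i)))   ≡⟨ cong (λ z → to (a * z)) (strictlyInverseʳ _) ⟩
        to (a * (b * from i))             ≡⟨ cong to (*-assoc a b (from i)) ⟨
        to ((a * b) * from i)             ≡⟨ cong (λ z → to (z * from i)) ab≡1 ⟩
        to (1# * from i)                  ≡⟨ cong to (*-identityˡ (from i)) ⟩
        to (from i)                       ≡⟨ strictlyInverseˡ i ⟩
        i                                 ∎

    ∏f≡P : ∏ f ≡ P
    ∏f≡P = begin
      ∏ f                               ≡⟨ sum-cong-≗ (λ i → cong orOne (strictlyInverseʳ (x * from i))) ⟨
      ∏ (orOne ∘ from ∘ (π ⟨$⟩ʳ_))      ≡⟨ sum-permute (orOne ∘ from) π ⟨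
      P                                 ∎

    f≡g-off-0 : ∀ j → j ≢ to 0# → f j ≡ g j
    f≡g-off-0 j j≢0 = orOne-*ˡ x≢0 (λ fromj≡0 → j≢0 (trans (sym (strictlyInverseˡ j)) (cong to fromj≡0)))

    f₀≡1 : f (to 0#) ≡ 1#
    f₀≡1 = trans (cong (λ z → orOne (x * z)) (strictlyInverseʳ 0#)) (trans (cong orOne (zeroʳ x)) orOne-0)

    g₀≡x : g (to 0#) ≡ x
    g₀≡x = trans (cong (λ z → x * orOne z) (strictlyInverseʳ 0#)) (trans (cong (x *_) orOne-0) (*-identityʳ x))

  x^′[q∸1]≡1 : ∀ {x} → x ≢ 0# → x ^′ (q ∸ 1) ≡ 1#
  x^′[q∸1]≡1 {x} x≢0 = *-cancelˡ x≢0 (begin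
    x * x ^′ (q ∸ 1)   ≡⟨ cong (x ^′_) (ℕ.suc-pred q {{ℕ.m^n≢0 2 n}}) ⟩
    x ^′ q             ≡⟨ x^′q≡x x≢0 ⟩
    x                  ≡⟨ *-identityʳ x ⟨
    x * 1#             ∎)

  x^′[k*[q∸1]]≡1 : ∀ {x} → x ≢ 0# → ∀ k → x ^′ (k ℕ.* (q ∸ 1)) ≡ 1#
  x^′[k*[q∸1]]≡1 {x} x≢0 k = begin
    x ^′ (k ℕ.* (q ∸ 1))    ≡⟨ cong (x ^′_) (ℕ.*-comm k (q ∸ 1)) ⟩
    x ^′ ((q ∸ 1) ℕ.* k)    ≡⟨ ^′-*-assoc x (q ∸ 1) k ⟨
    (x ^′ (q ∸ 1)) ^′ k     ≡⟨ cong (_^′ k) (x^′[q∸1]≡1 x≢0) ⟩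
    1# ^′ k                 ≡⟨ 1^′k≡1 k ⟩
    1#                      ∎

  -- Bézout: 1 + y (q - 1) = x m makes a^x an m-th root of a; 1 + x m = y (q - 1) does the same for a⁻¹^x.
  coprime⇒root : ∀ {m} → Coprime m (q ∸ 1) → ∀ {a} → a ≢ 0# → ∃ λ ε → ε ^′ m ≡ a
  coprime⇒root {m} coprime {a} a≢0 with coprime-Bézout coprime
  ... | Bézout.+- x y eq = a ^′ x , (begin
    (a ^′ x) ^′ m                   ≡⟨ ^′-*-assoc a x m ⟩
    a ^′ (x ℕ.* m)                  ≡⟨ cong (a ^′_) eq ⟨
    a * a ^′ (y ℕ.* (q ∸ 1))        ≡⟨ cong (a *_) (x^′[k*[q∸1]]≡1 a≢0 y) ⟩
    a * 1#                          ≡⟨ *-identityʳ a ⟩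
    a                               ∎)
  ... | Bézout.-+ x y eq = b ^′ x , *-cancelˡ (x⁻¹≢0 a≢0) (begin
    b * (b ^′ x) ^′ m               ≡⟨ cong (b *_) (^′-*-assoc b x m) ⟩
    b ^′ (1 ℕ.+ x ℕ.* m)            ≡⟨ cong (b ^′_) eq ⟩
    b ^′ (y ℕ.* (q ∸ 1))            ≡⟨ x^′[k*[q∸1]]≡1 (x⁻¹≢0 a≢0) y ⟩
    1#                              ≡⟨ x⁻¹*x≡1 a≢0 ⟨
    b * a                           ∎)
    where b = a ⁻¹⟨ a≢0 ⟩

  Polynomial : Set ℓ
  Polynomial = List Carrier

  eval : Polynomial → Carrier → Carrier
  eval []       x = 0#
  eval (c ∷ cs) x = c + x * eval cs x

  IsZero : Polynomial → Set ℓ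
  IsZero = All (_≡ 0#)

  eval-[c] : ∀ c x → eval (c ∷ []) x ≡ c
  eval-[c] c x = trans (cong (c +_) (zeroʳ x)) (+-identityʳ c)

  quotient : Carrier → Polynomial → Polynomial
  quotient a []           = []
  quotient a (c ∷ [])     = []
  quotient a (c ∷ d ∷ ds) = eval (d ∷ ds) a ∷ quotient a (d ∷ ds)

  -- p = (X - a) · quotient a p + p(a), with both sides moved so that no subtraction occurs.
  eval-quotient : ∀ a p x → eval p x + a * eval (quotient a p) x ≡ x * eval (quotient a p) x + eval p a
  eval-quotient a []           x = begin
    0# + a * 0#                   ≡⟨ +-identityˡ _ ⟩
    a * 0#                        ≡⟨ zeroʳ a ⟩
    0#                            ≡⟨ zeroʳ x ⟨
    x * 0#                        ≡⟨ +-identityʳ _ ⟨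
    x * 0# + 0#                   ∎
  eval-quotient a (c ∷ [])     x = begin
    eval (c ∷ []) x + a * 0#      ≡⟨ cong₂ _+_ (eval-[c] c x) (zeroʳ a) ⟩
    c + 0#                        ≡⟨ +-comm c 0# ⟩
    0# + c                        ≡⟨ cong₂ _+_ (zeroʳ x) (eval-[c] c a) ⟨
    x * 0# + eval (c ∷ []) a      ∎
  eval-quotient a (c ∷ d ∷ ds) x = begin
    (c + x * E) + a * (r + x * Q)   ≡⟨ solve 6 (λ c x a E Q r → ((c ⊕ x ⊗ E) ⊕ a ⊗ (r ⊕ x ⊗ Q)) ⊜ ((c ⊕ a ⊗ r) ⊕ x ⊗ (E ⊕ a ⊗ Q))) refl c x a E Q r ⟩
    (c + a * r) + x * (E + a * Q)   ≡⟨ cong (λ e → (c + a * r) + x * e) (eval-quotient a (d ∷ ds) x) ⟩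
    (c + a * r) + x * (x * Q + r)   ≡⟨ solve 5 (λ c x a Q r → ((c ⊕ a ⊗ r) ⊕ x ⊗ (x ⊗ Q ⊕ r)) ⊜ (x ⊗ (r ⊕ x ⊗ Q) ⊕ (c ⊕ a ⊗ r))) refl c x a Q r ⟩
    x * (r + x * Q) + (c + a * r)   ∎
    where
    E = eval (d ∷ ds) x
    Q = eval (quotient a (d ∷ ds)) x
    r = eval (d ∷ ds) a

  length-quotient : ∀ a c cs → length (quotient a (c ∷ cs)) ≡ length cs
  length-quotient a c []       = refl
  length-quotient a c (d ∷ ds) = cong suc (length-quotient a d ds)

  root-quotient-IsZero⇒IsZero : ∀ a p → eval p a ≡ 0# → IsZero (quotient a p) → IsZero p
  root-quotient-IsZero⇒IsZero a []           _    _           = []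
  root-quotient-IsZero⇒IsZero a (c ∷ [])     pa≡0 _           = trans (sym (eval-[c] c a)) pa≡0 ∷ []
  root-quotient-IsZero⇒IsZero a (c ∷ d ∷ ds) pa≡0 (r≡0 ∷ quotient≡0) =
    c≡0 ∷ root-quotient-IsZero⇒IsZero a (d ∷ ds) r≡0 quotient≡0
    where
    c≡0 : c ≡ 0#
    c≡0 = begin
      c                         ≡⟨ +-identityʳ c ⟨
      c + 0#                    ≡⟨ cong (c +_) (zeroʳ a) ⟨
      c + a * 0#                ≡⟨ cong (λ r → c + a * r) r≡0 ⟨
      c + a * eval (d ∷ ds) a   ≡⟨ pa≡0 ⟩
      0#                        ∎

  roots⇒IsZero : ∀ {k} (pts : Vector Carrier k) → Injective _≡_ _≡_ pts →
                 ∀ p → length p ≤ k → (∀ i → eval p (pts i) ≡ 0#) → IsZero p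
  roots⇒IsZero         pts injective []       _          _     = []
  roots⇒IsZero {suc k} pts injective (c ∷ cs) (s≤s len≤) roots =
    root-quotient-IsZero⇒IsZero a (c ∷ cs) (roots Fin.zero)
      (roots⇒IsZero (pts ∘ Fin.suc) (suc-injective ∘ injective) (quotient a (c ∷ cs))
        (subst (_≤ k) (sym (length-quotient a c cs)) len≤) quotient-roots)
    where
    a = pts Fin.zero
    quotient-roots : ∀ i → eval (quotient a (c ∷ cs)) (pts (Fin.suc i)) ≡ 0#
    quotient-roots i with eval (quotient a (c ∷ cs)) (pts (Fin.suc i)) ≟ 0#
    ... | yes Q≡0 = Q≡0
    ... | no  Q≢0 = contradiction (injective (*-cancelʳ Q≢0 bQ≡aQ)) λ ()
      where
      b = pts (Fin.suc i)
      Q = eval (quotient a (c ∷ cs)) b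
      bQ≡aQ : b * Q ≡ a * Q
      bQ≡aQ = begin
        b * Q                     ≡⟨ +-identityʳ _ ⟨
        b * Q + 0#                ≡⟨ cong (b * Q +_) (roots Fin.zero) ⟨
        b * Q + eval (c ∷ cs) a   ≡⟨ eval-quotient a (c ∷ cs) b ⟨
        eval (c ∷ cs) b + a * Q   ≡⟨ cong (_+ a * Q) (roots (Fin.suc i)) ⟩
        0# + a * Q                ≡⟨ +-identityˡ _ ⟩
        a * Q                     ∎

  vanishing⇒IsZero : ∀ p → length p ≤ q → (∀ x → eval p x ≡ 0#) → IsZero p
  vanishing⇒IsZero p len≤q vanishes = roots⇒IsZero from from-injective p len≤q (vanishes ∘ from)

  infixl 6 _+ₚ_
  _+ₚ_ : Polynomial → Polynomial → Polynomial
  []       +ₚ p′       = p′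
  (c ∷ cs) +ₚ []       = c ∷ cs
  (c ∷ cs) +ₚ (d ∷ ds) = c + d ∷ cs +ₚ ds

  eval-+ₚ : ∀ p p′ x → eval (p +ₚ p′) x ≡ eval p x + eval p′ x
  eval-+ₚ []       p′       x = sym (+-identityˡ _)
  eval-+ₚ (c ∷ cs) []       x = sym (+-identityʳ _)
  eval-+ₚ (c ∷ cs) (d ∷ ds) x = begin
    (c + d) + x * eval (cs +ₚ ds) x          ≡⟨ cong (λ e → (c + d) + x * e) (eval-+ₚ cs ds x) ⟩
    (c + d) + x * (eval cs x + eval ds x)    ≡⟨ solve 5 (λ c d x a b → ((c ⊕ d) ⊕ x ⊗ (a ⊕ b)) ⊜ ((c ⊕ x ⊗ a) ⊕ (d ⊕ x ⊗ b))) refl c d x _ _ ⟩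
    (c + x * eval cs x) + (d + x * eval ds x) ∎

  length-+ₚ : ∀ p p′ → length (p +ₚ p′) ≡ length p ℕ.⊔ length p′
  length-+ₚ []       p′       = refl
  length-+ₚ (c ∷ cs) []       = refl
  length-+ₚ (c ∷ cs) (d ∷ ds) = cong suc (length-+ₚ cs ds)

  coeff : Polynomial → ℕ → Carrier
  coeff []       _       = 0#
  coeff (c ∷ cs) zero    = c
  coeff (c ∷ cs) (suc i) = coeff cs i

  coeff-+ₚ : ∀ p p′ i → coeff (p +ₚ p′) i ≡ coeff p i + coeff p′ i
  coeff-+ₚ []       p′       i       = sym (+-identityˡ _)
  coeff-+ₚ (c ∷ cs) []       i       = sym (+-identityʳ _)
  coeff-+ₚ (c ∷ cs) (d ∷ ds) zero    = refl
  coeff-+ₚ (c ∷ cs) (d ∷ ds) (suc i) = coeff-+ₚ cs ds i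

  IsZero⇒coeff≡0 : ∀ {p} → IsZero p → ∀ i → coeff p i ≡ 0#
  IsZero⇒coeff≡0 []           i       = refl
  IsZero⇒coeff≡0 (c≡0 ∷ _)    zero    = c≡0
  IsZero⇒coeff≡0 (_ ∷ cs≡0)   (suc i) = IsZero⇒coeff≡0 cs≡0 i

  binomial : ℕ → Polynomial
  binomial zero    = 1# ∷ []
  binomial (suc k) = binomial k +ₚ (0# ∷ binomial k)

  eval-binomial : ∀ k x → eval (binomial k) x ≡ (x + 1#) ^′ k
  eval-binomial zero    x = eval-[c] 1# x
  eval-binomial (suc k) x = begin
    eval (binomial k +ₚ (0# ∷ binomial k)) x   ≡⟨ eval-+ₚ (binomial k) (0# ∷ binomial k) x ⟩
    B + (0# + x * B)                           ≡⟨ cong (B +_) (+-identityˡ (x * B)) ⟩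
    B + x * B                                  ≡⟨ cong (_+ x * B) (*-identityˡ B) ⟨
    1# * B + x * B                             ≡⟨ distribʳ B 1# x ⟨
    (1# + x) * B                               ≡⟨ cong (_* B) (+-comm 1# x) ⟩
    (x + 1#) * B                               ≡⟨ cong ((x + 1#) *_) (eval-binomial k x) ⟩
    (x + 1#) * (x + 1#) ^′ k                   ∎
    where B = eval (binomial k) x

  length-binomial : ∀ k → length (binomial k) ≡ suc k
  length-binomial zero    = refl
  length-binomial (suc k) = begin
    length (binomial k +ₚ (0# ∷ binomial k))     ≡⟨ length-+ₚ (binomial k) (0# ∷ binomial k) ⟩
    length (binomial k) ℕ.⊔ suc (length (binomial k)) ≡⟨ cong (λ l → l ℕ.⊔ suc l) (length-binomial k) ⟩
    suc k ℕ.⊔ suc (suc k)                        ≡⟨ ℕ.m≤n⇒m⊔n≡n (ℕ.n≤1+n (suc k)) ⟩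
    suc (suc k)                                  ∎

  coeff-binomial-0 : ∀ k → coeff (binomial k) 0 ≡ 1#
  coeff-binomial-0 zero    = refl
  coeff-binomial-0 (suc k) = trans (coeff-+ₚ (binomial k) (0# ∷ binomial k) 0)
    (trans (cong (_+ 0#) (coeff-binomial-0 k)) (+-identityʳ 1#))

  coeff-binomial-1 : ∀ k → coeff (binomial (suc k)) 1 ≡ coeff (binomial k) 1 + 1#
  coeff-binomial-1 k = trans (coeff-+ₚ (binomial k) (0# ∷ binomial k) 1)
    (cong (coeff (binomial k) 1 +_) (coeff-binomial-0 k))

  monomial : ℕ → Polynomial
  monomial zero    = 1# ∷ []
  monomial (suc k) = 0# ∷ monomial k

  eval-monomial : ∀ k x → eval (monomial k) x ≡ x ^′ k
  eval-monomial zero    x = eval-[c] 1# x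
  eval-monomial (suc k) x = trans (+-identityˡ _) (cong (x *_) (eval-monomial k x))

  length-monomial : ∀ k → length (monomial k) ≡ suc k
  length-monomial zero    = refl
  length-monomial (suc k) = cong suc (length-monomial k)

  -- If g y ≢ g z, the slope a = (z - y) / (g y - g z) makes y and z collide.
  perturbations-injective⇒constant : ∀ (g : Carrier → Carrier) →
    (∀ {a} → a ≢ 0# → Injective _≡_ _≡_ (λ y → a * g y + y)) → ∀ y z → g y ≡ g z
  perturbations-injective⇒constant g injective y z with g y ≟ g z
  ... | yes gy≡gz = gy≡gz
  ... | no  gy≢gz = contradiction (injective a≢0 collision) (gy≢gz ∘ cong g)
    where
    d≢0 : g y - g z ≢ 0#
    d≢0 = gy≢gz ∘ x∙y⁻¹≈ε⇒x≈y (g y) (g z)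

    a : Carrier
    a = (z - y) * (g y - g z) ⁻¹⟨ d≢0 ⟩

    a≢0 : a ≢ 0#
    a≢0 = x*y≢0 (λ z-y≡0 → gy≢gz (cong g (sym (x∙y⁻¹≈ε⇒x≈y z y z-y≡0)))) (x⁻¹≢0 d≢0)

    a*d≡z-y : a * (g y - g z) ≡ z - y
    a*d≡z-y = begin
      ((z - y) * (g y - g z) ⁻¹⟨ d≢0 ⟩) * (g y - g z)  ≡⟨ *-assoc (z - y) _ _ ⟩
      (z - y) * ((g y - g z) ⁻¹⟨ d≢0 ⟩ * (g y - g z))  ≡⟨ cong ((z - y) *_) (x⁻¹*x≡1 d≢0) ⟩
      (z - y) * 1#                                    ≡⟨ *-identityʳ (z - y) ⟩
      z - y                                           ∎

    collision : a * g y + y ≡ a * g z + z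
    collision = begin
      a * g y + y                         ≡⟨ cong (λ u → a * u + y) (//-rightDividesˡ (g z) (g y)) ⟨
      a * ((g y - g z) + g z) + y         ≡⟨ cong (_+ y) (distribˡ a (g y - g z) (g z)) ⟩
      (a * (g y - g z) + a * g z) + y     ≡⟨ cong (λ u → (u + a * g z) + y) a*d≡z-y ⟩
      ((z - y) + a * g z) + y             ≡⟨ solve 3 (λ e u y → ((e ⊕ u) ⊕ y) ⊜ (u ⊕ (e ⊕ y))) refl (z - y) (a * g z) y ⟩
      a * g z + ((z - y) + y)             ≡⟨ cong (a * g z +_) (//-rightDividesˡ y z) ⟩
      a * g z + z                         ∎

  module Characteristic2 (1+1≡0 : 1# + 1# ≡ 0#) where

    x+x≡0 : ∀ x → x + x ≡ 0#
    x+x≡0 x = begin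
      x + x               ≡⟨ cong₂ _+_ (*-identityʳ x) (*-identityʳ x) ⟨
      x * 1# + x * 1#     ≡⟨ distribˡ x 1# 1# ⟨
      x * (1# + 1#)       ≡⟨ cong (x *_) 1+1≡0 ⟩
      x * 0#              ≡⟨ zeroʳ x ⟩
      0#                  ∎

    x≡[x+y]+y : ∀ x y → x ≡ (x + y) + y
    x≡[x+y]+y x y = begin
      x                   ≡⟨ +-identityʳ x ⟨
      x + 0#              ≡⟨ cong (x +_) (x+x≡0 y) ⟨
      x + (y + y)         ≡⟨ +-assoc x y y ⟨
      (x + y) + y         ∎

    x+y≡0⇒x≡y : ∀ {x y} → x + y ≡ 0# → x ≡ y
    x+y≡0⇒x≡y {x} {y} x+y≡0 = trans (x≡[x+y]+y x y) (trans (cong (_+ y) x+y≡0) (+-identityˡ y))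

    [x+y]²≡x²+y² : ∀ x y → (x + y) * (x + y) ≡ x * x + y * y
    [x+y]²≡x²+y² x y = begin
      (x + y) * (x + y)                  ≡⟨ solve 2 (λ x y → ((x ⊕ y) ⊗ (x ⊕ y)) ⊜ ((x ⊗ x ⊕ y ⊗ y) ⊕ (x ⊗ y ⊕ x ⊗ y))) refl x y ⟩
      (x * x + y * y) + (x * y + x * y)  ≡⟨ cong (x * x + y * y +_) (x+x≡0 (x * y)) ⟩
      (x * x + y * y) + 0#               ≡⟨ +-identityʳ _ ⟩
      x * x + y * y                      ∎

    square-injective : ∀ {x y} → x * x ≡ y * y → x ≡ y
    square-injective {x} {y} x²≡y² with x*y≡0⇒x≡0⊎y≡0 [x+y]²≡0
      where
      [x+y]²≡0 : (x + y) * (x + y) ≡ 0#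
      [x+y]²≡0 = trans ([x+y]²≡x²+y² x y) (trans (cong (_+ y * y) x²≡y²) (x+x≡0 (y * y)))
    ... | inj₁ x+y≡0 = x+y≡0⇒x≡y x+y≡0
    ... | inj₂ x+y≡0 = x+y≡0⇒x≡y x+y≡0

    ShiftAdditive : ℕ → Set ℓ
    ShiftAdditive s = ∀ y → (y + 1#) ^′ s ≡ y ^′ s + 1#

    shiftAdditive-half : ∀ {k} → ShiftAdditive (k ℕ.+ k) → ShiftAdditive k
    shiftAdditive-half {k} additive y = square-injective (begin
      (y + 1#) ^′ k * (y + 1#) ^′ k   ≡⟨ ^′-distribˡ-+-* (y + 1#) k k ⟨
      (y + 1#) ^′ (k ℕ.+ k)           ≡⟨ additive y ⟩
      y ^′ (k ℕ.+ k) + 1#             ≡⟨ cong₂ _+_ (^′-distribˡ-+-* y k k) (sym (*-identityʳ 1#)) ⟩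
      y ^′ k * y ^′ k + 1# * 1#       ≡⟨ [x+y]²≡x²+y² (y ^′ k) 1# ⟨
      (y ^′ k + 1#) * (y ^′ k + 1#)   ∎)

    coeff-binomial-odd : ∀ h → coeff (binomial (suc (h ℕ.+ h))) 1 ≡ 1#
    coeff-binomial-odd zero    = trans (coeff-binomial-1 0) (+-identityˡ 1#)
    coeff-binomial-odd (suc h) = begin
      coeff (binomial (suc (suc h ℕ.+ suc h))) 1     ≡⟨ cong (λ k → coeff (binomial (suc (suc k))) 1) (ℕ.+-suc h h) ⟩
      coeff (binomial (suc (suc (suc (h ℕ.+ h))))) 1 ≡⟨ coeff-binomial-1 (suc (suc (h ℕ.+ h))) ⟩
      coeff (binomial (suc (suc (h ℕ.+ h)))) 1 + 1#  ≡⟨ cong (_+ 1#) (coeff-binomial-1 (suc (h ℕ.+ h))) ⟩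
      (coeff (binomial (suc (h ℕ.+ h))) 1 + 1#) + 1# ≡⟨ x≡[x+y]+y _ 1# ⟨
      coeff (binomial (suc (h ℕ.+ h))) 1             ≡⟨ coeff-binomial-odd h ⟩
      1#                                             ∎

    ¬shiftAdditive-odd : ∀ h → let s = suc (suc h ℕ.+ suc h) in s < q → ¬ ShiftAdditive s
    ¬shiftAdditive-odd h s<q additive =
      1≢0 (trans (sym coeff₁P≡1) (IsZero⇒coeff≡0 (vanishing⇒IsZero P length≤q P-vanishes) 1))
      where
      s = suc (suc h ℕ.+ suc h)
      P = binomial s +ₚ (monomial s +ₚ (1# ∷ []))

      P-vanishes : ∀ x → eval P x ≡ 0#
      P-vanishes x = begin
        eval P x                                            ≡⟨ eval-+ₚ (binomial s) _ x ⟩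
        eval (binomial s) x + eval (monomial s +ₚ (1# ∷ [])) x ≡⟨ cong (eval (binomial s) x +_) (eval-+ₚ (monomial s) (1# ∷ []) x) ⟩
        eval (binomial s) x + (eval (monomial s) x + eval (1# ∷ []) x)
                                                            ≡⟨ cong₂ (λ a b → a + (b + eval (1# ∷ []) x)) (eval-binomial s x) (eval-monomial s x) ⟩
        (x + 1#) ^′ s + (x ^′ s + eval (1# ∷ []) x)         ≡⟨ cong₂ (λ a b → a + (x ^′ s + b)) (additive x) (eval-[c] 1# x) ⟩
        (x ^′ s + 1#) + (x ^′ s + 1#)                       ≡⟨ x+x≡0 _ ⟩
        0#                                                  ∎

      length-P : length P ≡ suc s
      length-P = begin
        length P                                                ≡⟨ length-+ₚ (binomial s) _ ⟩
        length (binomial s) ℕ.⊔ length (monomial s +ₚ (1# ∷ [])) ≡⟨ cong (length (binomial s) ℕ.⊔_) (length-+ₚ (monomial s) (1# ∷ [])) ⟩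
        length (binomial s) ℕ.⊔ (length (monomial s) ℕ.⊔ 1)    ≡⟨ cong₂ (λ a b → a ℕ.⊔ (b ℕ.⊔ 1)) (length-binomial s) (length-monomial s) ⟩
        suc s ℕ.⊔ (suc s ℕ.⊔ 1)                                 ≡⟨ ℕ.m≥n⇒m⊔n≡m (ℕ.m≤n⊔m 1 (suc s)) ⟩
        suc s                                                   ∎

      length≤q : length P ≤ q
      length≤q = ℕ.≤-trans (ℕ.≤-reflexive length-P) s<q

      coeff₁P≡1 : coeff P 1 ≡ 1#
      coeff₁P≡1 = begin
        coeff P 1                                                ≡⟨ coeff-+ₚ (binomial s) _ 1 ⟩
        coeff (binomial s) 1 + coeff (monomial s +ₚ (1# ∷ [])) 1 ≡⟨ cong₂ _+_ (coeff-binomial-odd (suc h)) (coeff-+ₚ (monomial s) (1# ∷ []) 1) ⟩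
        1# + (0# + 0#)                                           ≡⟨ cong (1# +_) (+-identityʳ 0#) ⟩
        1# + 0#                                                  ≡⟨ +-identityʳ 1# ⟩
        1#                                                       ∎

    shiftAdditive⇒power-of-2 : ∀ s → 1 ≤ s → s < q → ShiftAdditive s → ∃ λ k → s ≡ 2 ^ k
    shiftAdditive⇒power-of-2 = <-rec _ step
      where
      step : ∀ s → (∀ {h} → h < s → 1 ≤ h → h < q → ShiftAdditive h → ∃ λ k → h ≡ 2 ^ k) →
             1 ≤ s → s < q → ShiftAdditive s → ∃ λ k → s ≡ 2 ^ k
      step s rec 1≤s s<q additive with evenOdd s
      ... | even zero    = contradiction 1≤s λ ()
      ... | even (suc h) = suc k , h+h≡2^[1+k]
        where
        h<s : suc h < suc h ℕ.+ suc h
        h<s = ℕ.m<m+n (suc h) (s≤s z≤n)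
        result = rec h<s (s≤s z≤n) (ℕ.<-trans h<s s<q) (shiftAdditive-half {suc h} additive)
        k = proj₁ result
        h+h≡2^[1+k] : suc h ℕ.+ suc h ≡ 2 ^ suc k
        h+h≡2^[1+k] = trans (cong (λ x → x ℕ.+ x) (proj₂ result)) (cong (2 ^ k ℕ.+_) (sym (ℕ.+-identityʳ (2 ^ k))))
      ... | odd zero     = 0 , refl
      ... | odd (suc h)  = contradiction additive (¬shiftAdditive-odd h s<q)

  module PlanarMonomial (c : Carrier) (c≢0 : c ≢ 0#) (m : ℕ) .{{_ : NonZero m}}
                        (coprime : Coprime m (q ∸ 1)) (planar : Planar (λ x → c * x ^′ (2 ℕ.+ m))) where

    t : ℕ
    t = 2 ℕ.+ m

    g : Carrier → Carrier
    g y = (y + 1#) ^′ t + y ^′ t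

    difference-scaled : ∀ ε y → c * (ε * y + ε) ^′ t + c * (ε * y) ^′ t + ε * (ε * y) ≡ (ε * ε) * ((c * ε ^′ m) * g y + y)
    difference-scaled ε y = begin
      c * (ε * y + ε) ^′ t + c * (ε * y) ^′ t + ε * (ε * y)
        ≡⟨ cong (λ u → c * u ^′ t + c * (ε * y) ^′ t + ε * (ε * y)) εy+ε≡ε[y+1] ⟩
      c * (ε * (y + 1#)) ^′ t + c * (ε * y) ^′ t + ε * (ε * y)
        ≡⟨ cong₂ (λ u v → c * u + c * v + ε * (ε * y)) (^′-distribʳ-* ε (y + 1#) t) (^′-distribʳ-* ε y t) ⟩
      c * (ε * (ε * ε ^′ m) * (y + 1#) ^′ t) + c * (ε * (ε * ε ^′ m) * y ^′ t) + ε * (ε * y)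
        ≡⟨ cong₂ (λ u v → c * (u * (y + 1#) ^′ t) + c * (u * y ^′ t) + v) (*-assoc ε ε (ε ^′ m)) (*-assoc ε ε y) ⟨
      c * ((ε * ε) * ε ^′ m * (y + 1#) ^′ t) + c * ((ε * ε) * ε ^′ m * y ^′ t) + (ε * ε) * y
        ≡⟨ solve 6 (λ c ε² εᵐ Y₁ Y y → (c ⊗ (ε² ⊗ εᵐ ⊗ Y₁) ⊕ c ⊗ (ε² ⊗ εᵐ ⊗ Y) ⊕ ε² ⊗ y)
                                       ⊜ (ε² ⊗ ((c ⊗ εᵐ) ⊗ (Y₁ ⊕ Y) ⊕ y))) refl c (ε * ε) (ε ^′ m) ((y + 1#) ^′ t) (y ^′ t) y ⟩
      (ε * ε) * ((c * ε ^′ m) * g y + y) ∎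
      where
      εy+ε≡ε[y+1] : ε * y + ε ≡ ε * (y + 1#)
      εy+ε≡ε[y+1] = trans (cong (ε * y +_) (sym (*-identityʳ ε))) (sym (distribˡ ε y 1#))

    perturbation-injective : ∀ {a} → a ≢ 0# → Injective _≡_ _≡_ (λ y → a * g y + y)
    perturbation-injective {a} a≢0 {y₁} {y₂} eq = *-cancelˡ ε≢0 (proj₁ (planar ε ε≢0) (begin
      c * (ε * y₁ + ε) ^′ t + c * (ε * y₁) ^′ t + ε * (ε * y₁) ≡⟨ difference-scaled ε y₁ ⟩
      (ε * ε) * ((c * ε ^′ m) * g y₁ + y₁)                     ≡⟨ cong (λ u → (ε * ε) * (u * g y₁ + y₁)) cεᵐ≡a ⟩
      (ε * ε) * (a * g y₁ + y₁)                                ≡⟨ cong ((ε * ε) *_) eq ⟩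
      (ε * ε) * (a * g y₂ + y₂)                                ≡⟨ cong (λ u → (ε * ε) * (u * g y₂ + y₂)) cεᵐ≡a ⟨
      (ε * ε) * ((c * ε ^′ m) * g y₂ + y₂)                     ≡⟨ difference-scaled ε y₂ ⟨
      c * (ε * y₂ + ε) ^′ t + c * (ε * y₂) ^′ t + ε * (ε * y₂) ∎))
      where
      c⁻¹ = c ⁻¹⟨ c≢0 ⟩
      a*c⁻¹≢0 : a * c⁻¹ ≢ 0#
      a*c⁻¹≢0 = x*y≢0 a≢0 (x⁻¹≢0 c≢0)
      root = coprime⇒root coprime a*c⁻¹≢0
      ε = proj₁ root
      ε≢0 : ε ≢ 0#
      ε≢0 ε≡0 = a*c⁻¹≢0 (trans (sym (proj₂ root)) (trans (cong (_^′ m) ε≡0) (0^′k≡0 m)))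
      cεᵐ≡a : c * ε ^′ m ≡ a
      cεᵐ≡a = begin
        c * ε ^′ m      ≡⟨ cong (c *_) (proj₂ root) ⟩
        c * (a * c⁻¹)   ≡⟨ solve 3 (λ c a c⁻¹ → (c ⊗ (a ⊗ c⁻¹)) ⊜ (a ⊗ (c ⊗ c⁻¹))) refl c a c⁻¹ ⟩
        a * (c * c⁻¹)   ≡⟨ cong (a *_) (x*x⁻¹≡1 c≢0) ⟩
        a * 1#          ≡⟨ *-identityʳ a ⟩
        a               ∎

    g≡1 : ∀ y → g y ≡ 1#
    g≡1 y = begin
      g y                      ≡⟨ perturbations-injective⇒constant g perturbation-injective y 0# ⟩
      (0# + 1#) ^′ t + 0# ^′ t ≡⟨ cong₂ _+_ (cong (_^′ t) (+-identityˡ 1#)) (0^′k≡0 t) ⟩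
      1# ^′ t + 0#             ≡⟨ +-identityʳ _ ⟩
      1# ^′ t                  ≡⟨ 1^′k≡1 t ⟩
      1#                       ∎

    characteristic-2 : 1# + 1# ≡ 0#
    characteristic-2 = x^′k≡0⇒x≡0 t (∙-cancelʳ 1# _ _ (begin
      (1# + 1#) ^′ t + 1#        ≡⟨ cong ((1# + 1#) ^′ t +_) (1^′k≡1 t) ⟨
      g 1#                       ≡⟨ g≡1 1# ⟩
      1#                         ≡⟨ +-identityˡ 1# ⟨
      0# + 1#                    ∎))

    open Characteristic2 characteristic-2

    shiftAdditive : ShiftAdditive t
    shiftAdditive y = begin
      (y + 1#) ^′ t                      ≡⟨ x≡[x+y]+y _ (y ^′ t) ⟩
      ((y + 1#) ^′ t + y ^′ t) + y ^′ t  ≡⟨ cong (_+ y ^′ t) (g≡1 y) ⟩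
      1# + y ^′ t                        ≡⟨ +-comm 1# (y ^′ t) ⟩
      y ^′ t + 1#                        ∎

open import Data.Integer using (+_; _-_; 1ℤ)
open import Data.Integer.GCD using (gcd)
import Data.Integer.Properties as ℤ

proposition3p4 : ∀ {ℓ : Level} (n : ℕ) → .{{_ : NonZero n}} → (F : FiniteField n ℓ) → (t : ℕ) →
    1 ≤ t → t ≤ 2 ^ n ∸ 2 → gcd (+ t - + 2) (+ (2 ^ n ∸ 1)) ≡ 1ℤ →
    (∃ λ c → ¬ (c ≡ FiniteField.0# F) × FiniteField.Planar F (λ x → FiniteField._*_ F c (FiniteField._^′_ F x t))) →
    ∃ λ k → t ≡ 2 ^ k
proposition3p4 n F 1 _ _ _ _ = 0 , refl
proposition3p4 n F 2 _ _ _ _ = 1 , refl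
proposition3p4 n F t@(suc (suc (suc m))) 1≤t t≤q∸2 gcd≡1 (c , c≢0 , planar) =
  shiftAdditive⇒power-of-2 t 1≤t t<q shiftAdditive
  where
  open FiniteFieldTheory F using (q; module PlanarMonomial; module Characteristic2)
  open PlanarMonomial c c≢0 (suc m) (gcd≡1⇒coprime (ℤ.+-injective gcd≡1)) planar
    using (characteristic-2; shiftAdditive)
  open Characteristic2 characteristic-2 using (shiftAdditive⇒power-of-2)

  2<q : 2 < q
  2<q = ℕ.m∸n≢0⇒n<m (λ q∸2≡0 → contradiction (subst (t ≤_) q∸2≡0 t≤q∸2) λ ())

  t<q : t < q
  t<q = ℕ.≤-<-trans t≤q∸2 (ℕ.∸-monoʳ-< (s≤s z≤n) (ℕ.<⇒≤ 2<q))
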